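{- Let $n\geq 1$ and let $C\subseteq\{0,1\}^n$ be a local identifying code in the binary $n$-dimensional hypercube. Then the code $C'=\{(a,\mathbf{c}) : a\in\{0,1\},\ \mathbf{c}\in C\}\subseteq\{0,1\}^{n+1}$ is a local identifying code in the binary $(n+1)$-dimensional hypercube if and only if $|I_C(\mathbf{c})|\geq 2$ for every $\mathbf{c}\in C$.
   Context: The binary $n$-dimensional hypercube is the graph with vertex set $\{0,1\}^n$ in which two binary words are adjacent iff their Hamming distance is $1$. For a vertex $u$, $N[u]$ is its closed neighbourhood, and for a code (nonempty vertex subset) $C$, $I_C(u)=N[u]\cap C$. A code $C$ is a covering code if $I_C(u)\neq\emptyset$ for every vertex $u$. A code $C$ is a local identifying code if it is a covering code and $I_C(u)\neq I_C(v)$ for every pair of adjacent vertices $u,v$. -}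

module Defs where

open import Data.Nat using (ℕ; zero; suc; _+_; _≥_)
open import Data.Bool using (Bool; true; false; if_then_else_)
open import Data.Vec using (Vec; []; _∷_)
open import Data.Product using (Σ; ∃; _×_; _,_)
open import Relation.Binary.PropositionalEquality using (_≡_; _≢_)
open import Relation.Nullary using (¬_)
open import Data.Sum using (_⊎_)
open import Function.Bundles using (_⇔_)

Word : ℕ → Set
Word n = Vec Bool n

hamming : ∀ {n} → Word n → Word n → ℕ
hamming [] [] = 0
hamming (x ∷ xs) (y ∷ ys) = (if eqb x y then 0 else 1) + hamming xs ys
  where
  eqb : Bool → Bool → Bool
  eqb true true = true
  eqb false false = true
  eqb _ _ = false

Adj : ∀ {n} → Word n → Word n → Set
Adj u v = hamming u v ≡ 1

InN : ∀ {n} → Word n → Word n → Set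
InN u w = (w ≡ u) ⊎ Adj u w

Code : ℕ → Set
Code n = Word n → Bool

_∈C_ : ∀ {n} → Word n → Code n → Set
w ∈C C = C w ≡ true

InI : ∀ {n} → Code n → Word n → Word n → Set
InI C u w = InN u w × (w ∈C C)

Nonempty : ∀ {n} → Code n → Set
Nonempty {n} C = Σ (Word n) λ w → w ∈C C

IsCovering : ∀ {n} → Code n → Set
IsCovering {n} C = (u : Word n) → Σ (Word n) λ w → InI C u w

SameI : ∀ {n} → Code n → Word n → Word n → Set
SameI {n} C u v = (w : Word n) → InI C u w ⇔ InI C v w

IsLocalIdentifying : ∀ {n} → Code n → Set
IsLocalIdentifying {n} C =
  Nonempty C × IsCovering C × ((u v : Word n) → Adj u v → ¬ SameI C u v)

AtLeastTwo : ∀ {n} → Code n → Word n → Set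
AtLeastTwo {n} C u =
  Σ (Word n) λ w₁ → Σ (Word n) λ w₂ → w₁ ≢ w₂ × InI C u w₁ × InI C u w₂

extend : ∀ {n} → Code n → Code (suc n)
extend C (a ∷ c) = C c

-- Write C' for the extension of C. A word b ∷ w lies in I_C'(a ∷ u) iff either b = a and
-- w ∈ I_C(u), or b ≠ a, w = u and u ∈ C. So the adjacent pairs a ∷ u, a ∷ v of C' are
-- separated because C separates u, v, and the only remaining adjacent pairs a ∷ u, b ∷ u
-- with a ≠ b are separated iff I_C(u) ⊈ {u}. As C covers u, I_C(u) ⊆ {u} means
-- I_C(u) = {u}, which is exactly the failure of |I_C(u)| ≥ 2 at a codeword u.
module Submission where

open import Defs
open import Data.Nat using (ℕ; zero; suc; _≥_) renaming (_≟_ to _≟ℕ_)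
open import Data.Nat.Properties using (suc-injective)
open import Data.Bool using (false; true)
open import Data.Bool.Properties using () renaming (_≟_ to _≟ᵇ_)
open import Data.Vec using ([]; _∷_)
open import Data.Vec.Properties using (∷-injectiveˡ; ∷-injectiveʳ; ≡-dec)
open import Data.Product using (Σ; _×_; _,_; proj₁; proj₂)
open import Data.Sum using (_⊎_; inj₁; inj₂)
open import Function.Base using (_∘_)
open import Function.Bundles using (_⇔_; mk⇔; Equivalence)
open import Function.Construct.Composition using (_⇔-∘_)
open import Function.Construct.Symmetry using (⇔-sym)
open import Relation.Binary.PropositionalEquality
open import Relation.Nullary using (¬_; Dec; yes; no; contradiction)
open import Relation.Nullary.Decidable using (¬?; _×-dec_; _⊎-dec_; map′; decidable-stable)

open Equivalence using (to; from)

_≟_ : ∀ {n} (u v : Word n) → Dec (u ≡ v)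
_≟_ = ≡-dec _≟ᵇ_

∃-Word? : ∀ n {P : Word n → Set} → (∀ w → Dec (P w)) → Dec (Σ (Word n) P)
∃-Word? zero P? = map′ ([] ,_) (λ { ([] , p) → p }) (P? [])
∃-Word? (suc n) {P} P? =
  map′ join split (∃-Word? n (P? ∘ (false ∷_)) ⊎-dec ∃-Word? n (P? ∘ (true ∷_)))
  where
  join : Σ (Word n) (P ∘ (false ∷_)) ⊎ Σ (Word n) (P ∘ (true ∷_)) → Σ (Word (suc n)) P
  join (inj₁ (w , p)) = false ∷ w , p
  join (inj₂ (w , p)) = true ∷ w , p

  split : Σ (Word (suc n)) P → Σ (Word n) (P ∘ (false ∷_)) ⊎ Σ (Word n) (P ∘ (true ∷_))
  split (false ∷ w , p) = inj₁ (w , p)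
  split (true ∷ w , p) = inj₂ (w , p)

hamming-refl : ∀ {n} (u : Word n) → hamming u u ≡ 0
hamming-refl [] = refl
hamming-refl (false ∷ u) = hamming-refl u
hamming-refl (true ∷ u) = hamming-refl u

hamming≡0⇒≡ : ∀ {n} {u v : Word n} → hamming u v ≡ 0 → u ≡ v
hamming≡0⇒≡ {u = []} {[]} _ = refl
hamming≡0⇒≡ {u = false ∷ u} {false ∷ v} h = cong (false ∷_) (hamming≡0⇒≡ h)
hamming≡0⇒≡ {u = true ∷ u} {true ∷ v} h = cong (true ∷_) (hamming≡0⇒≡ h)

hamming-∷-≡ : ∀ {n} a (u v : Word n) → hamming (a ∷ u) (a ∷ v) ≡ hamming u v
hamming-∷-≡ false u v = refl
hamming-∷-≡ true u v = refl

hamming-∷-≢ : ∀ {n a b} (u v : Word n) → a ≢ b → hamming (a ∷ u) (b ∷ v) ≡ suc (hamming u v)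
hamming-∷-≢ {a = false} {false} u v a≢b = contradiction refl a≢b
hamming-∷-≢ {a = false} {true} u v a≢b = refl
hamming-∷-≢ {a = true} {false} u v a≢b = refl
hamming-∷-≢ {a = true} {true} u v a≢b = contradiction refl a≢b

Adj-∷-≡ : ∀ {n} a (u v : Word n) → Adj (a ∷ u) (a ∷ v) ⇔ Adj u v
Adj-∷-≡ a u v = mk⇔ (trans (sym (hamming-∷-≡ a u v))) (trans (hamming-∷-≡ a u v))

Adj-∷-≢⇒≡ : ∀ {n a b} {u v : Word n} → a ≢ b → Adj (a ∷ u) (b ∷ v) → u ≡ v
Adj-∷-≢⇒≡ {u = u} {v} a≢b adj =
  hamming≡0⇒≡ (suc-injective (trans (sym (hamming-∷-≢ u v a≢b)) adj))

Adj-flip : ∀ {n a b} (u : Word n) → a ≢ b → Adj (a ∷ u) (b ∷ u)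
Adj-flip u a≢b = trans (hamming-∷-≢ u u a≢b) (cong suc (hamming-refl u))

InI? : ∀ {n} (C : Code n) (u w : Word n) → Dec (InI C u w)
InI? C u w = (w ≟ u ⊎-dec hamming u w ≟ℕ 1) ×-dec C w ≟ᵇ true

I⊆Self : ∀ {n} → Code n → Word n → Set
I⊆Self {n} C u = (w : Word n) → InI C u w → w ≡ u

module _ {n : ℕ} (C : Code n) where

  I⊆Self-or-AtLeastTwo : ∀ {c} → c ∈C C → I⊆Self C c ⊎ AtLeastTwo C c
  I⊆Self-or-AtLeastTwo {c} c∈C with ∃-Word? n (λ w → ¬? (w ≟ c) ×-dec InI? C c w)
  ... | yes (w , w≢c , w∈I) = inj₂ (c , w , w≢c ∘ sym , (inj₁ refl , c∈C) , w∈I)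
  ... | no ∄ = inj₁ λ w w∈I → decidable-stable (w ≟ c) (λ w≢c → ∄ (w , w≢c , w∈I))

  AtLeastTwo⇒¬I⊆Self : ∀ {u} → AtLeastTwo C u → ¬ I⊆Self C u
  AtLeastTwo⇒¬I⊆Self (w₁ , w₂ , w₁≢w₂ , w₁∈I , w₂∈I) s = w₁≢w₂ (trans (s w₁ w₁∈I) (sym (s w₂ w₂∈I)))

  I⊆Self⇒∈C : ∀ {u} → IsCovering C → I⊆Self C u → u ∈C C
  I⊆Self⇒∈C {u} cov s = let (w , w∈I) = cov u in subst (_∈C C) (s w w∈I) (proj₂ w∈I)

  I⊆Self⇒InI⇔ : ∀ {u} → I⊆Self C u → ∀ w → InI C u w ⇔ (w ≡ u × w ∈C C)
  I⊆Self⇒InI⇔ s w = mk⇔ (λ w∈I → s w w∈I , proj₂ w∈I) (λ (w≡u , w∈C) → inj₁ w≡u , w∈C)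

  InI-extend-≡ : ∀ a u w → InI (extend C) (a ∷ u) (a ∷ w) ⇔ InI C u w
  InI-extend-≡ a u w = mk⇔ to′ from′
    where
    to′ : InI (extend C) (a ∷ u) (a ∷ w) → InI C u w
    to′ (inj₁ eq , w∈C) = inj₁ (∷-injectiveʳ eq) , w∈C
    to′ (inj₂ adj , w∈C) = inj₂ (to (Adj-∷-≡ a u w) adj) , w∈C

    from′ : InI C u w → InI (extend C) (a ∷ u) (a ∷ w)
    from′ (inj₁ eq , w∈C) = inj₁ (cong (a ∷_) eq) , w∈C
    from′ (inj₂ adj , w∈C) = inj₂ (from (Adj-∷-≡ a u w) adj) , w∈C

  InI-extend-≢ : ∀ {a b} u w → a ≢ b → InI (extend C) (a ∷ u) (b ∷ w) ⇔ (w ≡ u × w ∈C C)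
  InI-extend-≢ u w a≢b = mk⇔ to′ from′
    where
    to′ : InI (extend C) (_ ∷ u) (_ ∷ w) → w ≡ u × w ∈C C
    to′ (inj₁ eq , _) = contradiction (sym (∷-injectiveˡ eq)) a≢b
    to′ (inj₂ adj , w∈C) = sym (Adj-∷-≢⇒≡ a≢b adj) , w∈C

    from′ : w ≡ u × w ∈C C → InI (extend C) (_ ∷ u) (_ ∷ w)
    from′ (refl , w∈C) = inj₂ (Adj-flip u a≢b) , w∈C

  I⊆Self⇒InI-extend⇔ : ∀ {u} → I⊆Self C u →
    ∀ a b w → InI (extend C) (a ∷ u) (b ∷ w) ⇔ (w ≡ u × w ∈C C)
  I⊆Self⇒InI-extend⇔ {u} s a b w with a ≟ᵇ b
  ... | yes refl = I⊆Self⇒InI⇔ s w ⇔-∘ InI-extend-≡ a u w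
  ... | no a≢b = InI-extend-≢ u w a≢b

  SameI-extend⁻ : ∀ a u v → SameI (extend C) (a ∷ u) (a ∷ v) → SameI C u v
  SameI-extend⁻ a u v S w = InI-extend-≡ a v w ⇔-∘ (S (a ∷ w) ⇔-∘ ⇔-sym (InI-extend-≡ a u w))

  SameI-extend-≢⇔I⊆Self : ∀ {a b} u → a ≢ b → SameI (extend C) (a ∷ u) (b ∷ u) ⇔ I⊆Self C u
  SameI-extend-≢⇔I⊆Self {a} {b} u a≢b = mk⇔ to′ from′
    where
    to′ : SameI (extend C) (a ∷ u) (b ∷ u) → I⊆Self C u
    to′ S w w∈I =
      proj₁ (to (InI-extend-≢ u w (a≢b ∘ sym)) (to (S (a ∷ w)) (from (InI-extend-≡ a u w) w∈I)))

    from′ : I⊆Self C u → SameI (extend C) (a ∷ u) (b ∷ u)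
    from′ s (c ∷ w) = ⇔-sym (I⊆Self⇒InI-extend⇔ s b c w) ⇔-∘ I⊆Self⇒InI-extend⇔ s a c w

  extend-covering : IsCovering C → IsCovering (extend C)
  extend-covering cov (a ∷ u) = let (w , w∈I) = cov u in a ∷ w , from (InI-extend-≡ a u w) w∈I

  extend-separating : ((u v : Word n) → Adj u v → ¬ SameI C u v) → IsCovering C →
    ((c : Word n) → c ∈C C → AtLeastTwo C c) →
    (u v : Word (suc n)) → Adj u v → ¬ SameI (extend C) u v
  extend-separating sep cov two (a ∷ u) (b ∷ v) adj S with a ≟ᵇ b
  ... | yes refl = sep u v (to (Adj-∷-≡ a u v) adj) (SameI-extend⁻ a u v S)
  ... | no a≢b with Adj-∷-≢⇒≡ {u = u} {v} a≢b adj
  ... | refl = AtLeastTwo⇒¬I⊆Self (two u (I⊆Self⇒∈C cov s)) s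
    where
    s : I⊆Self C u
    s = to (SameI-extend-≢⇔I⊆Self u a≢b) S

  AtLeastTwo⇒extend-identifying : IsLocalIdentifying C →
    ((c : Word n) → c ∈C C → AtLeastTwo C c) → IsLocalIdentifying (extend C)
  AtLeastTwo⇒extend-identifying ((w , w∈C) , cov , sep) two =
    (false ∷ w , w∈C) , extend-covering cov , extend-separating sep cov two

  extend-identifying⇒AtLeastTwo : IsLocalIdentifying (extend C) →
    (c : Word n) → c ∈C C → AtLeastTwo C c
  extend-identifying⇒AtLeastTwo (_ , _ , sep) c c∈C with I⊆Self-or-AtLeastTwo c∈C
  ... | inj₂ two = two
  ... | inj₁ s = contradiction (from (SameI-extend-≢⇔I⊆Self c false≢true) s)
                               (sep (false ∷ c) (true ∷ c) (Adj-flip c false≢true))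
    where
    false≢true : false ≢ true
    false≢true ()

mainTheorem7 : (n : ℕ) → n ≥ 1 → (C : Code n) → IsLocalIdentifying C →
    (IsLocalIdentifying (extend C) ⇔ ((c : Word n) → c ∈C C → AtLeastTwo C c))
mainTheorem7 n _ C li = mk⇔ (extend-identifying⇒AtLeastTwo C) (AtLeastTwo⇒extend-identifying C li)
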